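{- A disconnected graph $G$ with $n$ vertices satisfies $\Gamma_{\rho}(G)=n-1$ if and only if $G=K_1\cup G'$ (disjoint union), where $G'$ is a graph having a universal vertex.
   Context: Graphs are finite and simple; $d(u,v)$ is the distance in $G$ (infinite between different components). A universal vertex is one adjacent to all other vertices of its graph. A packing coloring $c:V(G)\to\{1,\dots,k\}$ satisfies: $c(u)=c(v)=i$, $u\ne v$, implies $d(u,v)>i$. The Grundy packing chromatic number $\Gamma_{\rho}(G)$ is the maximum number of colors $k$ in a packing coloring $c:V(G)\to\{1,\dots,k\}$ using all $k$ colors in which every vertex $v$ with $c(v)=i$ has, for every $j\in\{1,\dots,i-1\}$, a vertex $u$ with $c(u)=j$ and $d(u,v)\le j$ (equivalently, the maximum number of colors produced by the greedy procedure that processes vertices in some order and assigns each vertex the smallest color $i$ with no already-colored vertex of color $i$ at distance at most $i$). -}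

module Defs where

open import Data.Nat using (ℕ; zero; suc; _≤_; _<_; _∸_)
open import Data.Fin using (Fin)
open import Data.Bool using (Bool; true; false)
open import Data.Product using (Σ; ∃; ∃-syntax; _×_; _,_)
open import Relation.Nullary using (¬_)
open import Relation.Binary.PropositionalEquality using (_≡_; _≢_)

record Graph (n : ℕ) : Set where
  field
    adj       : Fin n → Fin n → Bool
    adj-sym   : ∀ u v → adj u v ≡ adj v u
    adj-irref : ∀ v → adj v v ≡ false

open Graph public

Adj : ∀ {n} → Graph n → Fin n → Fin n → Set
Adj G u v = adj G u v ≡ true

data Walk {n : ℕ} (G : Graph n) : Fin n → Fin n → ℕ → Set where
  here : ∀ {u} → Walk G u u zero
  step : ∀ {u w v ℓ} → Adj G u w → Walk G w v ℓ → Walk G u v (suc ℓ)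

-- d(u,v) ≤ k  (false for all k when u,v lie in different components,
-- i.e. d(u,v) = ∞).
DistLe : ∀ {n} → Graph n → Fin n → Fin n → ℕ → Set
DistLe G u v k = ∃[ ℓ ] (ℓ ≤ k × Walk G u v ℓ)

Connected : ∀ {n} → Graph n → Set
Connected G = ∀ u v → ∃[ k ] DistLe G u v k

Disconnected : ∀ {n} → Graph n → Set
Disconnected G = ¬ Connected G

IsPackingColoring : ∀ {n} → Graph n → ℕ → (Fin n → ℕ) → Set
IsPackingColoring {n} G k c =
  (∀ v → 1 ≤ c v × c v ≤ k) ×
  (∀ i → 1 ≤ i → i ≤ k → ∃[ v ] c v ≡ i) ×
  (∀ u v → u ≢ v → c u ≡ c v → ¬ DistLe G u v (c u))

IsGrundyPackingColoring : ∀ {n} → Graph n → ℕ → (Fin n → ℕ) → Set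
IsGrundyPackingColoring G k c =
  IsPackingColoring G k c ×
  (∀ v j → 1 ≤ j → j < c v → ∃[ u ] (c u ≡ j × DistLe G u v j))

HasGrundyPacking : ∀ {n} → Graph n → ℕ → Set
HasGrundyPacking {n} G k = Σ (Fin n → ℕ) (IsGrundyPackingColoring G k)

GrundyPackingNumberIs : ∀ {n} → Graph n → ℕ → Set
GrundyPackingNumberIs G m =
  HasGrundyPacking G m × (∀ k → HasGrundyPacking G k → k ≤ m)

Isolated : ∀ {n} → Graph n → Fin n → Set
Isolated G x = ∀ v → ¬ Adj G x v

-- G = K₁ ∪ G' with G' having a universal vertex: there is an isolated
-- vertex x (the K₁), and in G' = G − x some vertex y is adjacent to all
-- other vertices of G'.
IsK1UnionUniversal : ∀ {n} → Graph n → Set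
IsK1UnionUniversal {n} G =
  Σ (Fin n) λ x → Isolated G x ×
    Σ (Fin n) λ y → y ≢ x × (∀ z → z ≢ x → z ≢ y → Adj G y z)

{-# OPTIONS --safe #-}
-- In a Grundy packing coloring every vertex of color at least 2 has a neighbor of color 1,
-- so in a disconnected graph a single vertex of color 1 is impossible (it would be universal).
-- Hence besides one representative of each color there is a second vertex of color 1, and at
-- most n − 1 colors fit on n vertices.  If n − 1 colors are used, choose the representatives
-- in the component of a vertex of the top color (the Grundy condition puts every smaller color
-- near it); together with a second vertex p of color 1 they exhaust the vertices, so color 1
-- sits exactly on p and on the representative q.  If p were in that component every vertex
-- would reach q; so neither p nor any neighbor of p is a representative, which by counting
-- makes p isolated, and every other vertex, not being of color 1, is adjacent to q.
-- Conversely, for K₁ ∪ G' give the isolated vertex and the universal vertex of G' color 1 and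
-- the remaining vertices the colors 2, …, n − 1 bijectively.
module Submission where

open import Defs
open import Data.Nat using (ℕ; zero; suc; _∸_; _≤_; _<_; _+_; z≤n; s≤s)
open import Data.Nat.Properties using (≤-refl; ≤∧≢⇒<; <⇒≤pred; 1+n≰n; suc-injective)
import Data.Nat.Properties as ℕ
open import Data.Fin using (Fin; zero; suc; toℕ; fromℕ<; _≟_)
open import Data.Fin.Properties using (toℕ-injective; toℕ<n; toℕ-fromℕ<; injective⇒≤; any?)
open import Data.Fin.Permutation using (Permutation′; transpose; _∘ₚ_; _⟨$⟩ʳ_; _⟨$⟩ˡ_; inverseˡ; inverseʳ)
open import Data.Vec.Functional using (_∷_)
open import Data.Product using (Σ; ∃-syntax; _×_; _,_; proj₁; proj₂)
open import Data.Sum using (_⊎_; inj₁; inj₂; [_,_]′)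
open import Data.Empty using (⊥; ⊥-elim)
open import Function using (_∘_)
open import Function.Definitions using (Injective)
open import Relation.Nullary using (¬_; yes; no; ¬?; _×-dec_)
open import Relation.Nullary.Decidable using (dec-true; dec-false)
open import Relation.Binary.PropositionalEquality

module Walks {n : ℕ} (G : Graph n) where

  Reach : Fin n → Fin n → Set
  Reach u v = ∃[ ℓ ] Walk G u v ℓ

  Adj-sym : ∀ {u v} → Adj G u v → Adj G v u
  Adj-sym {u} {v} a = trans (adj-sym G v u) a

  Adj⇒≢ : ∀ {u v} → Adj G u v → u ≢ v
  Adj⇒≢ {u} a refl with trans (sym a) (adj-irref G u)
  ... | ()

  _++ʷ_ : ∀ {u v w ℓ ℓ′} → Walk G u v ℓ → Walk G v w ℓ′ → Walk G u w (ℓ + ℓ′)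
  here     ++ʷ q = q
  step a p ++ʷ q = step a (p ++ʷ q)

  snoc : ∀ {u v w ℓ} → Walk G u v ℓ → Adj G v w → Walk G u w (suc ℓ)
  snoc here       a = step a here
  snoc (step b p) a = step b (snoc p a)

  reverse : ∀ {u v ℓ} → Walk G u v ℓ → Walk G v u ℓ
  reverse here       = here
  reverse (step a p) = snoc (reverse p) (Adj-sym a)

  reach-trans : ∀ {u v w} → Reach u v → Reach v w → Reach u w
  reach-trans (ℓ , p) (ℓ′ , q) = ℓ + ℓ′ , p ++ʷ q

  reach-sym : ∀ {u v} → Reach u v → Reach v u
  reach-sym (ℓ , p) = ℓ , reverse p

  Adj⇒Reach : ∀ {u v} → Adj G u v → Reach u v
  Adj⇒Reach a = 1 , step a here

  DistLe⇒Reach : ∀ {u v k} → DistLe G u v k → Reach u v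
  DistLe⇒Reach (ℓ , _ , p) = ℓ , p

  DistLe-1⇒Adj : ∀ {u v} → u ≢ v → DistLe G u v 1 → Adj G u v
  DistLe-1⇒Adj u≢v (zero         , _      , here)        = ⊥-elim (u≢v refl)
  DistLe-1⇒Adj u≢v (suc zero     , _      , step a here) = a
  DistLe-1⇒Adj u≢v (suc (suc _)  , s≤s () , _)

  reach-hub⇒connected : (h : Fin n) → (∀ u → Reach u h) → Connected G
  reach-hub⇒connected h reach u v with reach-trans (reach u) (reach-sym (reach v))
  ... | ℓ , p = ℓ , ℓ , ≤-refl , p

∷-preserves-injectivity : ∀ {k n} {f : Fin k → Fin n} {u : Fin n} →
  Injective _≡_ _≡_ f → (∀ i → f i ≢ u) → Injective _≡_ _≡_ (u ∷ f)
∷-preserves-injectivity f-inj u∉f {zero}  {zero}  _ = refl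
∷-preserves-injectivity f-inj u∉f {zero}  {suc j} e = ⊥-elim (u∉f j (sym e))
∷-preserves-injectivity f-inj u∉f {suc i} {zero}  e = ⊥-elim (u∉f i e)
∷-preserves-injectivity f-inj u∉f {suc i} {suc j} e = cong suc (f-inj e)

Represents : ∀ {n k} → (Fin n → ℕ) → (Fin k → Fin n) → Set
Represents c r = ∀ i → c (r i) ≡ suc (toℕ i)

module _ {n k} {c : Fin n → ℕ} {r : Fin k → Fin n} (rep : Represents c r) where

  representatives-injective : Injective _≡_ _≡_ r
  representatives-injective {i} {j} e =
    toℕ-injective (suc-injective (trans (sym (rep i)) (trans (cong c e) (rep j))))

  ∉-representatives : ∀ {w i} → c w ≡ suc (toℕ i) → w ≢ r i → ∀ j → r j ≢ w
  ∉-representatives {w} {i} cw w≢rᵢ j e = w≢rᵢ (trans (sym e) (cong r j≡i))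
    where
    j≡i : j ≡ i
    j≡i = toℕ-injective (suc-injective (trans (sym (rep j)) (trans (cong c e) cw)))

module GrundyPackingColoring {n k} {G : Graph n} {c : Fin n → ℕ}
                             (γ : IsGrundyPackingColoring G k c) where
  open Walks G

  color-range : ∀ v → 1 ≤ c v × c v ≤ k
  color-range = proj₁ (proj₁ γ)

  color-used : ∀ j → 1 ≤ j → j ≤ k → ∃[ v ] c v ≡ j
  color-used = proj₁ (proj₂ (proj₁ γ))

  grundy : ∀ v j → 1 ≤ j → j < c v → ∃[ u ] (c u ≡ j × DistLe G u v j)
  grundy = proj₂ γ

  neighbor-of-color-1 : ∀ u → c u ≢ 1 → ∃[ w ] (c w ≡ 1 × Adj G w u)
  neighbor-of-color-1 u cu≢1
    with grundy u 1 ≤-refl (≤∧≢⇒< (proj₁ (color-range u)) (cu≢1 ∘ sym))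
  ... | w , cw≡1 , d = w , cw≡1 , DistLe-1⇒Adj (λ { refl → cu≢1 cw≡1 }) d

  smaller-color-reaches : ∀ v j → 1 ≤ j → j ≤ c v → ∃[ u ] (c u ≡ j × Reach u v)
  smaller-color-reaches v j 1≤j j≤cv with j ℕ.≟ c v
  ... | yes refl = v , refl , 0 , here
  ... | no j≢cv with grundy v j 1≤j (≤∧≢⇒< j≤cv j≢cv)
  ...   | u , cu≡j , d = u , cu≡j , DistLe⇒Reach d

  component-representatives : ∀ v → c v ≡ k →
    Σ (Fin k → Fin n) λ r → Represents c r × (∀ i → Reach (r i) v)
  component-representatives v cv≡k =
    (λ i → proj₁ (rep i)) , (λ i → proj₁ (proj₂ (rep i))) , (λ i → proj₂ (proj₂ (rep i)))
    where
    rep : (i : Fin k) → ∃[ u ] (c u ≡ suc (toℕ i) × Reach u v)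
    rep i = smaller-color-reaches v (suc (toℕ i)) (s≤s z≤n)
                                  (subst (suc (toℕ i) ≤_) (sym cv≡k) (toℕ<n i))

  color-1-reaches⇒connected : (h : Fin n) → (∀ w → c w ≡ 1 → Reach w h) → Connected G
  color-1-reaches⇒connected h color-1-reaches = reach-hub⇒connected h reach
    where
    reach : ∀ u → Reach u h
    reach u with c u ℕ.≟ 1
    ... | yes cu≡1 = color-1-reaches u cu≡1
    ... | no cu≢1 with neighbor-of-color-1 u cu≢1
    ...   | w , cw≡1 , a = reach-trans (Adj⇒Reach (Adj-sym a)) (color-1-reaches w cw≡1)

  another-vertex-of-color-1 : Disconnected G → ∀ q → ∃[ p ] (c p ≡ 1 × p ≢ q)
  another-vertex-of-color-1 disc q with any? (λ p → (c p ℕ.≟ 1) ×-dec ¬? (p ≟ q))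
  ... | yes found = found
  ... | no none = ⊥-elim (disc (color-1-reaches⇒connected q reach-q))
    where
    reach-q : ∀ w → c w ≡ 1 → Reach w q
    reach-q w cw≡1 with w ≟ q
    ... | yes refl = 0 , here
    ... | no w≢q = ⊥-elim (none (w , cw≡1 , w≢q))

  unrepresented-color-1 : Disconnected G → ∀ {r : Fin k → Fin n} → Represents c r →
    ∀ i → c (r i) ≡ 1 → ∃[ p ] (c p ≡ 1 × ∀ j → r j ≢ p)
  unrepresented-color-1 disc {r} rep i crᵢ≡1 with another-vertex-of-color-1 disc (r i)
  ... | p , cp≡1 , p≢rᵢ =
    p , cp≡1 , ∉-representatives rep (trans cp≡1 (trans (sym crᵢ≡1) (rep i))) p≢rᵢ

grundy-packing-bound : ∀ {n} {G : Graph n} → Disconnected G → ∀ k → HasGrundyPacking G k → k ≤ n ∸ 1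
grundy-packing-bound disc zero    _       = z≤n
grundy-packing-bound disc (suc k) (c , γ) =
  let open GrundyPackingColoring γ
      v , cv≡k    = color-used (suc k) (s≤s z≤n) ≤-refl
      r , rep , _ = component-representatives v cv≡k
      p , _ , p∉r = unrepresented-color-1 disc rep zero (rep zero)
  in  <⇒≤pred (injective⇒≤ (∷-preserves-injectivity (representatives-injective {c = c} rep) p∉r))

module ExtremalGrundyPacking {m} {G : Graph (suc (suc m))} (disc : Disconnected G)
                             {c : Fin (suc (suc m)) → ℕ} (γ : IsGrundyPackingColoring G (suc m) c) where
  open Walks G
  open GrundyPackingColoring γ

  top : ∃[ v ] c v ≡ suc m
  top = color-used (suc m) (s≤s z≤n) ≤-refl

  v : Fin (suc (suc m))
  v = proj₁ top

  component : Σ (Fin (suc m) → Fin (suc (suc m))) λ r → Represents c r × (∀ i → Reach (r i) v)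
  component = component-representatives v (proj₂ top)

  r : Fin (suc m) → Fin (suc (suc m))
  r = proj₁ component

  rep : Represents c r
  rep = proj₁ (proj₂ component)

  r-reach : ∀ i → Reach (r i) v
  r-reach = proj₂ (proj₂ component)

  q : Fin (suc (suc m))
  q = r zero

  spare : ∃[ p ] (c p ≡ 1 × ∀ j → r j ≢ p)
  spare = unrepresented-color-1 disc rep zero (rep zero)

  p : Fin (suc (suc m))
  p = proj₁ spare

  p∉r : ∀ j → r j ≢ p
  p∉r = proj₂ (proj₂ spare)

  no-two-unrepresented : ∀ {u w} → u ≢ w → (∀ i → r i ≢ u) → (∀ i → r i ≢ w) → ⊥
  no-two-unrepresented {u} {w} u≢w u∉r w∉r =
    1+n≰n (injective⇒≤ (∷-preserves-injectivity r+u-injective w∉r+u))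
    where
    r+u-injective : Injective _≡_ _≡_ (u ∷ r)
    r+u-injective = ∷-preserves-injectivity (representatives-injective {c = c} rep) u∉r
    w∉r+u : ∀ i → (u ∷ r) i ≢ w
    w∉r+u zero    = u≢w
    w∉r+u (suc i) = w∉r i

  color-1 : ∀ {z} → c z ≡ 1 → z ≡ p ⊎ z ≡ q
  color-1 {z} cz≡1 with z ≟ p | z ≟ q
  ... | yes z≡p | _       = inj₁ z≡p
  ... | no _    | yes z≡q = inj₂ z≡q
  ... | no z≢p  | no z≢q  =
    ⊥-elim (no-two-unrepresented (z≢p ∘ sym) p∉r (∉-representatives {c = c} rep cz≡1 z≢q))

  p-unreachable : ¬ Reach p v
  p-unreachable p⇝v = disc (color-1-reaches⇒connected q reach-q)
    where
    reach-q : ∀ w → c w ≡ 1 → Reach w q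
    reach-q w cw≡1 with color-1 cw≡1
    ... | inj₁ refl = reach-trans p⇝v (reach-sym (r-reach zero))
    ... | inj₂ refl = 0 , here

  p-isolated : Isolated G p
  p-isolated u a = no-two-unrepresented (Adj⇒≢ a) p∉r u∉r
    where
    u∉r : ∀ i → r i ≢ u
    u∉r i refl = p-unreachable (reach-trans (Adj⇒Reach a) (r-reach i))

  q-universal : ∀ z → z ≢ p → z ≢ q → Adj G q z
  q-universal z z≢p z≢q with neighbor-of-color-1 z (λ cz≡1 → [ z≢p , z≢q ]′ (color-1 cz≡1))
  ... | w , cw≡1 , a with color-1 cw≡1
  ...   | inj₁ refl = ⊥-elim (p-isolated z a)
  ...   | inj₂ refl = a

  K₁∪universal : IsK1UnionUniversal G
  K₁∪universal = p , p-isolated , q , p∉r zero , q-universal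

transpose-matchʳ : ∀ {n} (i j : Fin n) → transpose i j ⟨$⟩ʳ j ≡ i
transpose-matchʳ i j with j ≟ i
... | yes refl = refl
... | no _ rewrite dec-true (j ≟ j) refl = refl

transpose-other : ∀ {n} {i j k : Fin n} → k ≢ i → k ≢ j → transpose i j ⟨$⟩ʳ k ≡ k
transpose-other {i = i} {j} {k} k≢i k≢j rewrite dec-false (k ≟ i) k≢i | dec-false (k ≟ j) k≢j = refl

permutation-injective : ∀ {n} (π : Permutation′ n) → Injective _≡_ _≡_ (π ⟨$⟩ʳ_)
permutation-injective π {u} {v} e = begin
  u                    ≡⟨ inverseˡ π ⟨
  π ⟨$⟩ˡ (π ⟨$⟩ʳ u)    ≡⟨ cong (π ⟨$⟩ˡ_) e ⟩
  π ⟨$⟩ˡ (π ⟨$⟩ʳ v)    ≡⟨ inverseˡ π ⟩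
  v                    ∎
  where open ≡-Reasoning

permutation-to-0-1 : ∀ {m} {x y : Fin (suc (suc m))} → y ≢ x →
  Σ (Permutation′ (suc (suc m))) λ π → π ⟨$⟩ʳ x ≡ zero × π ⟨$⟩ʳ y ≡ suc zero
permutation-to-0-1 {x = x} {y} y≢x =
  transpose zero x ∘ₚ transpose (suc zero) t , πx , transpose-matchʳ (suc zero) t
  where
  t : Fin (suc (suc _))
  t = transpose zero x ⟨$⟩ʳ y
  t≢0 : zero ≢ t
  t≢0 0≡t = y≢x (permutation-injective (transpose zero x) (sym (trans (transpose-matchʳ zero x) 0≡t)))
  πx : transpose (suc zero) t ⟨$⟩ʳ (transpose zero x ⟨$⟩ʳ x) ≡ zero
  πx rewrite transpose-matchʳ zero x = transpose-other {i = suc zero} (λ ()) t≢0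

index-color : ∀ {m} → Fin (suc (suc m)) → ℕ
index-color zero    = 1
index-color (suc i) = suc (toℕ i)

index-color-range : ∀ {m} (s : Fin (suc (suc m))) → 1 ≤ index-color s × index-color s ≤ suc m
index-color-range zero    = s≤s z≤n , s≤s z≤n
index-color-range (suc i) = s≤s z≤n , toℕ<n i

index-color-surjective : ∀ {m} j → 1 ≤ j → j ≤ suc m → ∃[ s ] index-color {m} s ≡ j
index-color-surjective (suc j) _ j<1+m = suc (fromℕ< j<1+m) , cong suc (toℕ-fromℕ< j<1+m)

index-color≡1 : ∀ {m} {s : Fin (suc (suc m))} → index-color s ≡ 1 → s ≡ zero ⊎ s ≡ suc zero
index-color≡1 {s = zero}        _ = inj₁ refl
index-color≡1 {s = suc zero}    _ = inj₂ refl
index-color≡1 {s = suc (suc _)} ()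

index-color-injective : ∀ {m} {s t : Fin (suc (suc m))} →
  index-color s ≡ index-color t → index-color s ≢ 1 → s ≡ t
index-color-injective {s = zero}              _ c≢1 = ⊥-elim (c≢1 refl)
index-color-injective {s = suc _} {zero}      e c≢1 = ⊥-elim (c≢1 e)
index-color-injective {s = suc _} {suc _}     e _   = cong suc (toℕ-injective (suc-injective e))

module K₁∪UniversalColoring {m} {G : Graph (suc (suc m))} {x y : Fin (suc (suc m))}
                    (x-isolated : Isolated G x) (y≢x : y ≢ x)
                    (y-universal : ∀ z → z ≢ x → z ≢ y → Adj G y z) where
  open Walks G

  π : Permutation′ (suc (suc m))
  π = proj₁ (permutation-to-0-1 y≢x)

  πx≡0 : π ⟨$⟩ʳ x ≡ zero
  πx≡0 = proj₁ (proj₂ (permutation-to-0-1 y≢x))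

  πy≡1 : π ⟨$⟩ʳ y ≡ suc zero
  πy≡1 = proj₂ (proj₂ (permutation-to-0-1 y≢x))

  c : Fin (suc (suc m)) → ℕ
  c v = index-color (π ⟨$⟩ʳ v)

  cx≡1 : c x ≡ 1
  cx≡1 = cong index-color πx≡0

  cy≡1 : c y ≡ 1
  cy≡1 = cong index-color πy≡1

  c≡1 : ∀ {v} → c v ≡ 1 → v ≡ x ⊎ v ≡ y
  c≡1 cv≡1 with index-color≡1 cv≡1
  ... | inj₁ πv≡0 = inj₁ (permutation-injective π (trans πv≡0 (sym πx≡0)))
  ... | inj₂ πv≡1 = inj₂ (permutation-injective π (trans πv≡1 (sym πy≡1)))

  c-injective : ∀ {u v} → c u ≡ c v → c u ≢ 1 → u ≡ v
  c-injective cu≡cv cu≢1 = permutation-injective π (index-color-injective cu≡cv cu≢1)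

  color-1-independent : ∀ {u v} → c u ≡ 1 → c v ≡ 1 → ¬ Adj G u v
  color-1-independent {u} {v} cu≡1 cv≡1 a with c≡1 {u} cu≡1 | c≡1 {v} cv≡1
  ... | inj₁ refl | _         = x-isolated v a
  ... | _         | inj₁ refl = x-isolated u (Adj-sym a)
  ... | inj₂ refl | inj₂ refl = Adj⇒≢ a refl

  above-color⇒≢1 : ∀ {v j} → 1 ≤ j → j < c v → c v ≢ 1
  above-color⇒≢1 1≤j j<cv cv≡1 = ℕ.<⇒≱ (subst (_ <_) cv≡1 j<cv) 1≤j

  y-adjacent : ∀ {v} → c v ≢ 1 → Adj G y v
  y-adjacent {v} cv≢1 = y-universal v (λ { refl → cv≢1 cx≡1 }) (λ { refl → cv≢1 cy≡1 })

  color-used : ∀ j → 1 ≤ j → j ≤ suc m → ∃[ v ] c v ≡ j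
  color-used j 1≤j j≤1+m with index-color-surjective j 1≤j j≤1+m
  ... | s , cs≡j = π ⟨$⟩ˡ s , trans (cong index-color (inverseʳ π)) cs≡j

  packing : ∀ u v → u ≢ v → c u ≡ c v → ¬ DistLe G u v (c u)
  packing u v u≢v cu≡cv d with c u ℕ.≟ 1
  ... | yes cu≡1 = color-1-independent cu≡1 (trans (sym cu≡cv) cu≡1)
                     (DistLe-1⇒Adj u≢v (subst (DistLe G u v) cu≡1 d))
  ... | no cu≢1  = u≢v (c-injective cu≡cv cu≢1)

  grundy : ∀ v j → 1 ≤ j → j < c v → ∃[ u ] (c u ≡ j × DistLe G u v j)
  grundy v (suc zero) 1≤j 1<cv = y , cy≡1 , 1 , ≤-refl , step (y-adjacent cv≢1) here
    where
    cv≢1 : c v ≢ 1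
    cv≢1 = above-color⇒≢1 {v} 1≤j 1<cv
  grundy v (suc (suc j)) 1≤j j<cv
    with color-used (suc (suc j)) (s≤s z≤n)
                    (ℕ.≤-trans (ℕ.<⇒≤ j<cv) (proj₂ (index-color-range (π ⟨$⟩ʳ v))))
  ... | u , cu≡j =
    u , cu≡j , 2 , 2≤2+j , step (Adj-sym (y-adjacent cu≢1)) (step (y-adjacent cv≢1) here)
    where
    2≤2+j : 2 ≤ suc (suc j)
    2≤2+j = s≤s (s≤s z≤n)
    cu≢1 : c u ≢ 1
    cu≢1 = above-color⇒≢1 {u} (s≤s z≤n) (subst (1 <_) (sym cu≡j) 2≤2+j)
    cv≢1 : c v ≢ 1
    cv≢1 = above-color⇒≢1 {v} 1≤j j<cv

  grundy-packing : HasGrundyPacking G (suc m)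
  grundy-packing = c , ((λ v → index-color-range (π ⟨$⟩ʳ v)) , color-used , packing) , grundy

corollary8 : (n : ℕ) (G : Graph n) → Disconnected G →
    (GrundyPackingNumberIs G (n ∸ 1) → IsK1UnionUniversal G) ×
    (IsK1UnionUniversal G → GrundyPackingNumberIs G (n ∸ 1))
corollary8 zero          G disc = ⊥-elim (disc λ ())
corollary8 (suc zero)    G disc = ⊥-elim (disc λ { zero zero → 0 , 0 , z≤n , here })
corollary8 (suc (suc m)) G disc =
  (λ { ((c , γ) , _) → ExtremalGrundyPacking.K₁∪universal disc γ }) ,
  (λ { (x , x-isolated , y , y≢x , y-universal) →
         K₁∪UniversalColoring.grundy-packing x-isolated y≢x y-universal , grundy-packing-bound disc })
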